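{- Let $n = p_1^{\alpha_1} p_2^{\alpha_2}$, where $p_1 < p_2$ are odd primes and $\alpha_1 > 1$, $\alpha_2 > 1$ are integers. Then $n$ is nice.
   Context: Two congruences $a \pmod{b}$ and $a' \pmod{b'}$ overlap if there is an integer $x$ with $x \equiv a \pmod{b}$ and $x \equiv a' \pmod{b'}$. A finite set of congruences $\{a_1 \pmod{d_1}, \ldots, a_t \pmod{d_t}\}$ with pairwise distinct moduli $1 \leq d_1 < \cdots < d_t$ is called good if whenever two distinct congruences $a_i \pmod{d_i}$ and $a_j \pmod{d_j}$ of the set overlap, we have $\gcd(d_i,d_j)=1$. A positive integer $n$ is called nice if there exist integers $a_d$, one for each divisor $d$ of $n$ with $d>1$, such that $\{a_d \pmod{d} : d \mid n, d>1\}$ is a good set of congruences. -}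

module Defs where

open import Data.Nat using (ℕ; _<_; _^_; _*_)
open import Data.Nat.Divisibility using (_∣_)
open import Data.Nat.GCD using (gcd)
open import Data.Integer using (ℤ; +_; _-_)
import Data.Integer.Divisibility as ℤD
open import Data.Product using (∃)
open import Relation.Binary.PropositionalEquality using (_≡_; _≢_)

_≡[mod_]_ : ℤ → ℕ → ℤ → Set
x ≡[mod b ] a = (+ b) ℤD.∣ (x - a)

Overlap : ℤ → ℕ → ℤ → ℕ → Set
Overlap a b a' b' = ∃ λ (x : ℤ) → (x ≡[mod b ] a) × (x ≡[mod b' ] a')
  where open import Data.Product using (_×_)

Nice : ℕ → Set
Nice n = ∃ λ (a : ℕ → ℤ) →
  ∀ (d d' : ℕ) → d ∣ n → d' ∣ n → 1 < d → 1 < d' → d ≢ d' →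
  Overlap (a d) d (a d') d' → gcd d d' ≡ 1

module Submission where

-- Write a divisor as d = p^i q^j. For i > 0 require a_d ≡ c p^(i-1) (mod p^i), where the digit
-- c is 1 if q ∤ d and 2 if q ∣ d; symmetrically modulo q^j; the Chinese remainder theorem glues
-- the two conditions. Since p is odd it divides none of 1, 2 and 2 - 1, so x ≡ c p^k (mod p^(k+1))
-- with c ∈ {1, 2} determines both k (the p-adic valuation of x) and c. Hence if the classes of two
-- divisors that are both divisible by p meet, the divisors have the same p-exponent and agree on
-- whether q divides them; if q divides both, the same argument at q makes them equal. So distinct
-- divisors whose classes meet share no prime.

open import Defs

module PrimePowers where

  open import Data.Nat using (zero; suc; _*_; _^_; _≤_; _<_; z≤n; s≤s; nonTrivial⇒n>1; nonTrivial⇒≢1)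
  open import Data.Nat.Properties
  open import Data.Nat.Divisibility
  open import Data.Nat.Primality using (Prime; prime⇒nonZero; prime⇒nonTrivial; prime⇒irreducible)
  open import Data.Nat.Coprimality using (Coprime; coprime-divisor; 1-coprimeTo; prime⇒coprime)
    renaming (sym to coprime-sym)
  open import Data.Product using (∃; ∃₂; _×_; _,_)
  open import Data.Sum using (_⊎_; inj₁; inj₂)
  open import Function using (_∘_)
  open import Relation.Nullary using (¬_; yes; no; contradiction)
  open import Relation.Binary.PropositionalEquality

  odd-prime⇒>2 : ∀ {p} → Prime p → ¬ 2 ∣ p → 2 < p
  odd-prime⇒>2 {p} p-prime 2∤p = ≤∧≢⇒< (nonTrivial⇒n>1 p {{prime⇒nonTrivial p-prime}}) 2≢p
    where
    2≢p : 2 ≢ p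
    2≢p refl = 2∤p ∣-refl

  ^-monoʳ-∣ : ∀ m {i j} → i ≤ j → m ^ i ∣ m ^ j
  ^-monoʳ-∣ m {j = j} z≤n       = 1∣ (m ^ j)
  ^-monoʳ-∣ m         (s≤s i≤j) = *-monoʳ-∣ m (^-monoʳ-∣ m i≤j)

  coprime-*ˡ : ∀ {m n o} → Coprime m o → Coprime n o → Coprime (m * n) o
  coprime-*ˡ {m} {n} m⊥o n⊥o {d} (d∣mn , d∣o) = m⊥o (d∣m , d∣o)
    where
    d⊥n : Coprime d n
    d⊥n (e∣d , e∣n) = n⊥o (e∣n , ∣-trans e∣d d∣o)
    d∣m : d ∣ m
    d∣m = coprime-divisor d⊥n (subst (d ∣_) (*-comm m n) d∣mn)

  coprime-*ʳ : ∀ {m n o} → Coprime m n → Coprime m o → Coprime m (n * o)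
  coprime-*ʳ m⊥n m⊥o = coprime-sym (coprime-*ˡ (coprime-sym m⊥n) (coprime-sym m⊥o))

  coprime-^ˡ : ∀ {m n} i → Coprime m n → Coprime (m ^ i) n
  coprime-^ˡ {n = n} zero    m⊥n = 1-coprimeTo n
  coprime-^ˡ         (suc i) m⊥n = coprime-*ˡ m⊥n (coprime-^ˡ i m⊥n)

  coprime-^ʳ : ∀ {m n} j → Coprime m n → Coprime m (n ^ j)
  coprime-^ʳ j = coprime-sym ∘ coprime-^ˡ j ∘ coprime-sym

  coprime-^ : ∀ {m n} i j → Coprime m n → Coprime (m ^ i) (n ^ j)
  coprime-^ i j = coprime-^ˡ i ∘ coprime-^ʳ j

  coprime-^-^ : ∀ m {i j} → i ≡ 0 ⊎ j ≡ 0 → Coprime (m ^ i) (m ^ j)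
  coprime-^-^ m {j = j} (inj₁ refl) = 1-coprimeTo (m ^ j)
  coprime-^-^ m {i = i} (inj₂ refl) = coprime-sym (1-coprimeTo (m ^ i))

  coprime-^*^ : ∀ {p q i j i′ j′} → Coprime p q → i ≡ 0 ⊎ i′ ≡ 0 → j ≡ 0 ⊎ j′ ≡ 0 →
                Coprime (p ^ i * q ^ j) (p ^ i′ * q ^ j′)
  coprime-^*^ {p} {q} {i} {j} {i′} {j′} p⊥q i⊎i′ j⊎j′ = coprime-*ˡ
    (coprime-*ʳ (coprime-^-^ p i⊎i′) (coprime-^ i j′ p⊥q))
    (coprime-*ʳ (coprime-^ j i′ (coprime-sym p⊥q)) (coprime-^-^ q j⊎j′))

  prime<prime⇒coprime : ∀ {p q} → Prime p → Prime q → p < q → Coprime p q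
  prime<prime⇒coprime p-prime q-prime p<q =
    coprime-sym (prime⇒coprime q-prime {{prime⇒nonZero p-prime}} p<q)

  coprime⇒prime∤ : ∀ {p n} → Prime p → Coprime p n → ¬ p ∣ n
  coprime⇒prime∤ p-prime p⊥n p∣n = nonTrivial⇒≢1 {{prime⇒nonTrivial p-prime}} (p⊥n (∣-refl , p∣n))

  prime∤⇒coprime : ∀ {p n} → Prime p → ¬ p ∣ n → Coprime n p
  prime∤⇒coprime p-prime p∤n (d∣n , d∣p) with prime⇒irreducible p-prime d∣p
  ... | inj₁ d≡1  = d≡1
  ... | inj₂ refl = contradiction d∣n p∤n

  ∣p^a*m⇒≡p^i*e : ∀ {p m} → Prime p → ¬ p ∣ m → ∀ a {d} → d ∣ p ^ a * m →
                  ∃₂ λ i e → i ≤ a × e ∣ m × d ≡ p ^ i * e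
  ∣p^a*m⇒≡p^i*e {p} {m} p-prime p∤m zero {d} d∣m =
    0 , d , z≤n , subst (d ∣_) (+-identityʳ m) d∣m , sym (+-identityʳ d)
  ∣p^a*m⇒≡p^i*e {p} {m} p-prime p∤m (suc a) {d} d∣p^[1+a]m with p ∣? d
  ... | yes (divides e refl) =
    let instance _ = prime⇒nonZero p-prime
        pe∣p[p^am] = subst₂ _∣_ (*-comm e p) (*-assoc p (p ^ a) m) d∣p^[1+a]m
        (i , f , i≤a , f∣m , e≡p^if) = ∣p^a*m⇒≡p^i*e p-prime p∤m a (*-cancelˡ-∣ p pe∣p[p^am])
    in suc i , f , s≤s i≤a , f∣m , (begin
      e * p           ≡⟨ *-comm e p ⟩
      p * e           ≡⟨ cong (p *_) e≡p^if ⟩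
      p * (p ^ i * f) ≡⟨ *-assoc p (p ^ i) f ⟨
      p ^ suc i * f   ∎)
    where open ≡-Reasoning
  ... | no p∤d =
    let d∣p^am = coprime-divisor (prime∤⇒coprime p-prime p∤d)
                   (subst (d ∣_) (*-assoc p (p ^ a) m) d∣p^[1+a]m)
        (i , e , i≤a , e∣m , d≡p^ie) = ∣p^a*m⇒≡p^i*e p-prime p∤m a d∣p^am
    in i , e , m≤n⇒m≤1+n i≤a , e∣m , d≡p^ie

  ∣p^a⇒≡p^i : ∀ {p} → Prime p → ∀ a {d} → d ∣ p ^ a → ∃ λ i → i ≤ a × d ≡ p ^ i
  ∣p^a⇒≡p^i {p} p-prime a {d} d∣p^a
    with ∣p^a*m⇒≡p^i*e p-prime (coprime⇒prime∤ p-prime (coprime-sym (1-coprimeTo p))) a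
           (subst (d ∣_) (sym (*-identityʳ (p ^ a))) d∣p^a)
  ... | i , e , i≤a , e∣1 , d≡p^ie = i , i≤a , (begin
    d         ≡⟨ d≡p^ie ⟩
    p ^ i * e ≡⟨ cong (p ^ i *_) (∣1⇒≡1 e∣1) ⟩
    p ^ i * 1 ≡⟨ *-identityʳ (p ^ i) ⟩
    p ^ i     ∎)
    where open ≡-Reasoning

  ∣p^a*q^b⇒≡p^i*q^j : ∀ {p q} → Prime p → Prime q → Coprime p q → ∀ a b {d} → d ∣ p ^ a * q ^ b →
                      ∃₂ λ i j → i ≤ a × j ≤ b × d ≡ p ^ i * q ^ j
  ∣p^a*q^b⇒≡p^i*q^j {p} p-prime q-prime p⊥q a b d∣p^aq^b
    with ∣p^a*m⇒≡p^i*e p-prime (coprime⇒prime∤ p-prime (coprime-^ʳ b p⊥q)) a d∣p^aq^b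
  ... | i , e , i≤a , e∣q^b , d≡p^ie with ∣p^a⇒≡p^i q-prime b e∣q^b
  ...   | j , j≤b , e≡q^j = i , j , i≤a , j≤b , trans d≡p^ie (cong (p ^ i *_) e≡q^j)

module Congruences where

  open import Data.Nat as ℕ using (ℕ; suc)
  import Data.Nat.Properties as ℕ
  import Data.Nat.Divisibility as ℕ
  open import Data.Nat.Coprimality using (Coprime; coprime-Bézout)
  open import Data.Nat.GCD using (module Bézout)
  open import Data.Integer using (ℤ; +_; -_; _+_; _-_; _*_; 1ℤ)
  open import Data.Integer.Properties using (pos-*; neg-distribˡ-*; neg-involutive)
  open import Data.Integer.Divisibility.Signed
  open import Data.Integer.Tactic.RingSolver using (solve-∀)
  open import Data.Product using (∃; _×_; _,_)
  open import Data.Empty using (⊥-elim)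
  open import Relation.Nullary using (¬_)
  open import Relation.Binary.PropositionalEquality
  open import Relation.Binary.Definitions using (tri<; tri≈; tri>)
  open PrimePowers using (^-monoʳ-∣)

  ≡[mod]⇒∣ : ∀ {m} x y → x ≡[mod m ] y → + m ∣ x - y
  ≡[mod]⇒∣ x y = ∣ᵤ⇒∣

  ∣x-y∧∣y-z⇒∣x-z : ∀ {m} x y z → m ∣ x - y → m ∣ y - z → m ∣ x - z
  ∣x-y∧∣y-z⇒∣x-z x y z m∣x-y m∣y-z = subst (_ ∣_) (telescope x y z) (∣m∣n⇒∣m+n m∣x-y m∣y-z)
    where
    telescope : ∀ x y z → (x - y) + (y - z) ≡ x - z
    telescope = solve-∀

  pos-1+*≡* : ∀ a b c d → 1 ℕ.+ a ℕ.* b ≡ c ℕ.* d → 1ℤ + + a * + b ≡ + c * + d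
  pos-1+*≡* a b c d eq = begin
    1ℤ + + a * + b     ≡⟨ cong (_+_ 1ℤ) (pos-* a b) ⟨
    + (1 ℕ.+ a ℕ.* b)  ≡⟨ cong +_ eq ⟩
    + (c ℕ.* d)        ≡⟨ pos-* c d ⟩
    + c * + d          ∎
    where open ≡-Reasoning

  crt-idempotent : ∀ {m n} → Coprime m n → ∃ λ e → + m ∣ e - 1ℤ × + n ∣ e
  crt-idempotent {m} {n} m⊥n with coprime-Bézout m⊥n
  ... | Bézout.+- a b 1+bn≡am =
    - (+ b * + n) , divides (- + a) e-1≡-am , divides (- + b) (neg-distribˡ-* (+ b) (+ n))
    where
    open ≡-Reasoning
    -z-1≡-[1+z] : ∀ z → - z - 1ℤ ≡ - (1ℤ + z)
    -z-1≡-[1+z] = solve-∀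
    e-1≡-am : - (+ b * + n) - 1ℤ ≡ - + a * + m
    e-1≡-am = begin
      - (+ b * + n) - 1ℤ   ≡⟨ -z-1≡-[1+z] (+ b * + n) ⟩
      - (1ℤ + + b * + n)   ≡⟨ cong -_ (pos-1+*≡* b n a m 1+bn≡am) ⟩
      - (+ a * + m)        ≡⟨ neg-distribˡ-* (+ a) (+ m) ⟩
      - + a * + m          ∎
  ... | Bézout.-+ a b 1+am≡bn =
    + b * + n , divides (+ a) e-1≡am , divides (+ b) refl
    where
    open ≡-Reasoning
    1+z-1≡z : ∀ z → (1ℤ + z) - 1ℤ ≡ z
    1+z-1≡z = solve-∀
    e-1≡am : + b * + n - 1ℤ ≡ + a * + m
    e-1≡am = begin
      + b * + n - 1ℤ          ≡⟨ cong (_- 1ℤ) (pos-1+*≡* a m b n 1+am≡bn) ⟨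
      (1ℤ + + a * + m) - 1ℤ   ≡⟨ 1+z-1≡z (+ a * + m) ⟩
      + a * + m               ∎

  glue : ℤ → ℤ → ℤ → ℤ
  glue e a b = a * e + b * (1ℤ - e)

  glue-≡ˡ : ∀ {m} e a b → + m ∣ e - 1ℤ → + m ∣ glue e a b - a
  glue-≡ˡ e a b m∣e-1 = subst (_ ∣_) (sym (glue-a e a b)) (∣n⇒∣m*n (a - b) m∣e-1)
    where
    glue-a : ∀ e a b → (a * e + b * (1ℤ - e)) - a ≡ (a - b) * (e - 1ℤ)
    glue-a = solve-∀

  glue-≡ʳ : ∀ {m} e a b → + m ∣ e → + m ∣ glue e a b - b
  glue-≡ʳ e a b m∣e = subst (_ ∣_) (sym (glue-b e a b)) (∣n⇒∣m*n (a - b) m∣e)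
    where
    glue-b : ∀ e a b → (a * e + b * (1ℤ - e)) - b ≡ (a - b) * e
    glue-b = solve-∀

  module _ {p : ℕ} .{{_ : ℕ.NonZero p}} where

    cancel-power : ∀ k z → + (p ℕ.^ suc k) ∣ z * + (p ℕ.^ k) → + p ∣ z
    cancel-power k z p^[1+k]∣zp^k = *-cancelʳ-∣ (+ (p ℕ.^ k)) {{ℕ.m^n≢0 p k}}
      (subst (λ t → t ∣ z * + (p ℕ.^ k)) (pos-* p (p ℕ.^ k)) p^[1+k]∣zp^k)

    leading-term⇒∣ : ∀ k c x → + (p ℕ.^ suc k) ∣ x - c * + (p ℕ.^ k) → + (p ℕ.^ k) ∣ x
    leading-term⇒∣ k c x h = ∣m+n∣n⇒∣m (∣-trans p^k∣p^[1+k] h) (∣m⇒∣-m (∣n⇒∣m*n c ∣-refl))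
      where
      p^k∣p^[1+k] : + (p ℕ.^ k) ∣ + (p ℕ.^ suc k)
      p^k∣p^[1+k] = ∣ᵤ⇒∣ {+ (p ℕ.^ k)} {+ (p ℕ.^ suc k)} (ℕ.n∣m*n p)

    leading-term⇒∤ : ∀ k c x → ¬ + p ∣ c → + (p ℕ.^ suc k) ∣ x - c * + (p ℕ.^ k) →
                     ¬ + (p ℕ.^ suc k) ∣ x
    leading-term⇒∤ k c x p∤c h p^[1+k]∣x = p∤c (cancel-power k c p^[1+k]∣cp^k)
      where
      p^[1+k]∣cp^k : + (p ℕ.^ suc k) ∣ c * + (p ℕ.^ k)
      p^[1+k]∣cp^k = subst (_ ∣_) (neg-involutive _) (∣m⇒∣-m (∣m+n∣m⇒∣n h p^[1+k]∣x))

    leading-coefficient-∣ : ∀ k c d x → + (p ℕ.^ suc k) ∣ x - c * + (p ℕ.^ k) →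
                            + (p ℕ.^ suc k) ∣ x - d * + (p ℕ.^ k) → + p ∣ c - d
    leading-coefficient-∣ k c d x hc hd =
      cancel-power k (c - d) (subst (_ ∣_) (difference x c d (+ (p ℕ.^ k))) (∣m∣n⇒∣m-n hd hc))
      where
      difference : ∀ x c d z → (x - d * z) - (x - c * z) ≡ (c - d) * z
      difference = solve-∀

  valuation-unique : ∀ {p x} k l → + (p ℕ.^ k) ∣ x → ¬ + (p ℕ.^ suc k) ∣ x →
                     + (p ℕ.^ l) ∣ x → ¬ + (p ℕ.^ suc l) ∣ x → k ≡ l
  valuation-unique {p} k l p^k∣x p^[1+k]∤x p^l∣x p^[1+l]∤x with ℕ.<-cmp k l
  ... | tri< k<l _ _ = ⊥-elim (p^[1+k]∤x (∣-trans (∣ᵤ⇒∣ (^-monoʳ-∣ p k<l)) p^l∣x))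
  ... | tri≈ _ k≡l _ = k≡l
  ... | tri> _ _ l<k = ⊥-elim (p^[1+l]∤x (∣-trans (∣ᵤ⇒∣ (^-monoʳ-∣ p l<k)) p^k∣x))

  leading-term-unique : ∀ {p} .{{_ : ℕ.NonZero p}} k l c d x → ¬ + p ∣ c → ¬ + p ∣ d →
                        + (p ℕ.^ suc k) ∣ x - c * + (p ℕ.^ k) →
                        + (p ℕ.^ suc l) ∣ x - d * + (p ℕ.^ l) → k ≡ l × + p ∣ c - d
  leading-term-unique {p} k l c d x p∤c p∤d hc hd = k≡l , leading-coefficient-∣ k c d x hc hd′
    where
    k≡l = valuation-unique k l (leading-term⇒∣ k c x hc) (leading-term⇒∤ k c x p∤c hc)
                               (leading-term⇒∣ l d x hd) (leading-term⇒∤ l d x p∤d hd)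
    hd′ = subst (λ m → + (p ℕ.^ suc m) ∣ x - d * + (p ℕ.^ m)) (sym k≡l) hd


module LocalResidues where

  open import Data.Nat as ℕ using (ℕ; zero; suc; _<_)
  import Data.Nat.Properties as ℕ
  import Data.Nat.Divisibility as ℕ
  open import Data.Nat.Coprimality using (Coprime)
  open import Data.Integer using (ℤ; +_; _-_; _*_; 0ℤ; 1ℤ)
  open import Data.Integer.Divisibility.Signed using (_∣_; ∣⇒∣ᵤ)
  open import Data.Product using (_×_; _,_; proj₁; swap; map₂; uncurry)
  open import Data.Sum using (_⊎_; inj₁; inj₂)
  open import Data.Empty using (⊥-elim)
  open import Function using (_∘_)
  open import Relation.Nullary using (¬_)
  open import Relation.Binary.PropositionalEquality
  open PrimePowers using (coprime-^*^)
  open Congruences using (leading-term-unique)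

  digit : ℕ → ℤ
  digit zero    = 1ℤ
  digit (suc _) = + 2

  localResidue : ℕ → ℕ → ℕ → ℤ
  localResidue p zero    j = 0ℤ
  localResidue p (suc k) j = digit j * + (p ℕ.^ k)

  module _ {p : ℕ} (2<p : 2 < p) where

    private
      1<p : 1 < p
      1<p = ℕ.<-trans (ℕ.n<1+n 1) 2<p

      instance
        p≢0 : ℕ.NonZero p
        p≢0 = ℕ.>-nonZero (ℕ.<-trans ℕ.z<s 1<p)

    p∤digit : ∀ j → ¬ + p ∣ digit j
    p∤digit zero    p∣1 = ℕ.<⇒≱ 1<p (ℕ.∣⇒≤ (∣⇒∣ᵤ p∣1))
    p∤digit (suc _) p∣2 = ℕ.<⇒≱ 2<p (ℕ.∣⇒≤ (∣⇒∣ᵤ p∣2))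

    digit-≡ : ∀ j j′ → + p ∣ digit j - digit j′ → digit j ≡ digit j′
    digit-≡ zero    zero    _    = refl
    digit-≡ (suc _) (suc _) _    = refl
    digit-≡ zero    (suc _) p∣-1 = ⊥-elim (ℕ.<⇒≱ 1<p (ℕ.∣⇒≤ (∣⇒∣ᵤ p∣-1)))
    digit-≡ (suc _) zero    p∣1  = ⊥-elim (p∤digit zero p∣1)

    residue-unique : ∀ k l j j′ x → + (p ℕ.^ suc k) ∣ x - localResidue p (suc k) j →
                     + (p ℕ.^ suc l) ∣ x - localResidue p (suc l) j′ → k ≡ l × digit j ≡ digit j′
    residue-unique k l j j′ x hj hj′ =
      map₂ (digit-≡ j j′) (leading-term-unique k l (digit j) (digit j′) x (p∤digit j) (p∤digit j′) hj hj′)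

  record LocallyCongruent (p q : ℕ) (x : ℤ) (i j : ℕ) : Set where
    field
      p-part : + (p ℕ.^ i) ∣ x - localResidue p i j
      q-part : + (q ℕ.^ j) ∣ x - localResidue q j i

  LocallyCongruent-swap : ∀ {p q x i j} → LocallyCongruent p q x i j → LocallyCongruent q p x j i
  LocallyCongruent-swap c = record
    { p-part = LocallyCongruent.q-part c
    ; q-part = LocallyCongruent.p-part c
    }

  module _ {p q : ℕ} (2<p : 2 < p) (2<q : 2 < q) {x : ℤ} where

    digit-≡⇒≡ : ∀ {k k′} j j′ → LocallyCongruent p q x (suc k) j → LocallyCongruent p q x (suc k′) j′ →
                digit j ≡ digit j′ → j ≡ j′
    digit-≡⇒≡ zero    zero    _ _ _  = refl
    digit-≡⇒≡ {k} {k′} (suc l) (suc l′) c c′ _ = cong suc (proj₁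
      (residue-unique 2<q l l′ (suc k) (suc k′) x (LocallyCongruent.q-part c) (LocallyCongruent.q-part c′)))
    digit-≡⇒≡ zero    (suc _) _ _ ()
    digit-≡⇒≡ (suc _) zero    _ _ ()

    shared-p⇒same-exponents : ∀ {k k′} j j′ → LocallyCongruent p q x (suc k) j →
                              LocallyCongruent p q x (suc k′) j′ → k ≡ k′ × j ≡ j′
    shared-p⇒same-exponents {k} {k′} j j′ c c′ = map₂ (digit-≡⇒≡ j j′ c c′)
      (residue-unique 2<p k k′ j j′ x (LocallyCongruent.p-part c) (LocallyCongruent.p-part c′))

    distinct⇒p-exponent-zero : ∀ {i j i′ j′} → LocallyCongruent p q x i j → LocallyCongruent p q x i′ j′ →
                               (i , j) ≢ (i′ , j′) → i ≡ 0 ⊎ i′ ≡ 0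
    distinct⇒p-exponent-zero {zero}              _ _  _  = inj₁ refl
    distinct⇒p-exponent-zero {suc _} {i′ = zero} _ _  _  = inj₂ refl
    distinct⇒p-exponent-zero {suc _} {j} {suc _} {j′} c c′ ij≢i′j′ =
      ⊥-elim (ij≢i′j′ (uncurry (cong₂ (λ k j → suc k , j)) (shared-p⇒same-exponents j j′ c c′)))

  distinct⇒coprime : ∀ {p q x i j i′ j′} → 2 < p → 2 < q → Coprime p q →
    LocallyCongruent p q x i j → LocallyCongruent p q x i′ j′ → (i , j) ≢ (i′ , j′) →
    Coprime (p ℕ.^ i ℕ.* q ℕ.^ j) (p ℕ.^ i′ ℕ.* q ℕ.^ j′)
  distinct⇒coprime 2<p 2<q p⊥q c c′ ij≢i′j′ = coprime-^*^ p⊥q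
    (distinct⇒p-exponent-zero 2<p 2<q c c′ ij≢i′j′)
    (distinct⇒p-exponent-zero 2<q 2<p (LocallyCongruent-swap c) (LocallyCongruent-swap c′)
                                      (ij≢i′j′ ∘ cong swap))

module Construction where

  open import Data.Nat as ℕ using (ℕ; _≤_; _<_)
  open import Data.Nat.Divisibility as ℕ using (_∣?_; n∣m*n; m∣m*n)
  open import Data.Nat.Primality using (Prime)
  open import Data.Nat.GCD using (gcd)
  open import Data.Nat.Coprimality using (Coprime; coprime⇒gcd≡1)
  open import Data.Integer using (ℤ; +_; _-_; 0ℤ; 1ℤ)
  open import Data.Integer.Divisibility.Signed using (_∣_; ∣-trans; ∣ᵤ⇒∣)
  open import Data.Product using (∃; ∃₂; _×_; _,_; proj₁; proj₂)
  open import Function using (_∘_)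
  open import Relation.Nullary using (yes; no; contradiction)
  open import Relation.Binary.PropositionalEquality
  open PrimePowers
  open Congruences
  open LocalResidues

  module _ {p q : ℕ} (a b : ℕ) (p-prime : Prime p) (q-prime : Prime q)
           (2<p : 2 < p) (2<q : 2 < q) (p⊥q : Coprime p q) where

    idempotent : ∃ λ e → + (p ℕ.^ a) ∣ e - 1ℤ × + (q ℕ.^ b) ∣ e
    idempotent = crt-idempotent (coprime-^ a b p⊥q)

    e : ℤ
    e = proj₁ idempotent

    residue : ℕ → ℕ → ℤ
    residue i j = glue e (localResidue p i j) (localResidue q j i)

    residue⇒locallyCongruent : ∀ x {i j} → i ≤ a → j ≤ b →
                               x ≡[mod p ℕ.^ i ℕ.* q ℕ.^ j ] residue i j → LocallyCongruent p q x i j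
    residue⇒locallyCongruent x {i} {j} i≤a j≤b x≡residue = record
      { p-part = ∣x-y∧∣y-z⇒∣x-z x (residue i j) (localResidue p i j)
          (∣-trans (∣ᵤ⇒∣ (m∣m*n (q ℕ.^ j))) x-residue)
          (glue-≡ˡ e (localResidue p i j) (localResidue q j i) (∣-trans (∣ᵤ⇒∣ (^-monoʳ-∣ p i≤a)) p^a∣e-1))
      ; q-part = ∣x-y∧∣y-z⇒∣x-z x (residue i j) (localResidue q j i)
          (∣-trans (∣ᵤ⇒∣ (n∣m*n (p ℕ.^ i))) x-residue)
          (glue-≡ʳ e (localResidue p i j) (localResidue q j i) (∣-trans (∣ᵤ⇒∣ (^-monoʳ-∣ q j≤b)) q^b∣e))
      }
      where
      x-residue = ≡[mod]⇒∣ x (residue i j) x≡residue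
      p^a∣e-1 = proj₁ (proj₂ idempotent)
      q^b∣e   = proj₂ (proj₂ idempotent)

    residueOf : ℕ → ℤ
    residueOf d with d ∣? p ℕ.^ a ℕ.* q ℕ.^ b
    ... | yes d∣n = let (i , j , _) = ∣p^a*q^b⇒≡p^i*q^j p-prime q-prime p⊥q a b d∣n in residue i j
    ... | no _    = 0ℤ

    residueOf-factorisation : ∀ {d} → d ℕ.∣ p ℕ.^ a ℕ.* q ℕ.^ b →
      ∃₂ λ i j → i ≤ a × j ≤ b × d ≡ p ℕ.^ i ℕ.* q ℕ.^ j × residueOf d ≡ residue i j
    residueOf-factorisation {d} d∣n with d ∣? p ℕ.^ a ℕ.* q ℕ.^ b
    ... | yes d∣n′ =
      let (i , j , i≤a , j≤b , d≡p^iq^j) = ∣p^a*q^b⇒≡p^i*q^j p-prime q-prime p⊥q a b d∣n′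
      in i , j , i≤a , j≤b , d≡p^iq^j , refl
    ... | no d∤n = contradiction d∣n d∤n

    residueOf-good : ∀ d d′ → d ℕ.∣ p ℕ.^ a ℕ.* q ℕ.^ b → d′ ℕ.∣ p ℕ.^ a ℕ.* q ℕ.^ b → d ≢ d′ →
                     Overlap (residueOf d) d (residueOf d′) d′ → gcd d d′ ≡ 1
    residueOf-good d d′ d∣n d′∣n d≢d′ (x , x≡residueOf , x≡residueOf′)
      with residueOf-factorisation d∣n | residueOf-factorisation d′∣n
    ... | i , j , i≤a , j≤b , refl , d-residue | i′ , j′ , i′≤a , j′≤b , refl , d′-residue =
      coprime⇒gcd≡1 (distinct⇒coprime 2<p 2<q p⊥q
        (residue⇒locallyCongruent x i≤a j≤b (subst (x ≡[mod _ ]_) d-residue x≡residueOf))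
        (residue⇒locallyCongruent x i′≤a j′≤b (subst (x ≡[mod _ ]_) d′-residue x≡residueOf′))
        (d≢d′ ∘ cong (λ (i , j) → p ℕ.^ i ℕ.* q ℕ.^ j)))

    nice : Nice (p ℕ.^ a ℕ.* q ℕ.^ b)
    nice = residueOf , λ d d′ d∣n d′∣n _ _ → residueOf-good d d′ d∣n d′∣n

open import Data.Nat using (ℕ; _<_; _^_; _*_)
open import Data.Nat.Primality using (Prime)
open import Data.Nat.Divisibility using (_∣_)
open import Relation.Nullary using (¬_)
open PrimePowers using (odd-prime⇒>2; prime<prime⇒coprime)

lemma6 : (p₁ p₂ α₁ α₂ : ℕ) → Prime p₁ → Prime p₂ → ¬ (2 ∣ p₁) → ¬ (2 ∣ p₂) →
    p₁ < p₂ → 1 < α₁ → 1 < α₂ → Nice ((p₁ ^ α₁) * (p₂ ^ α₂))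
lemma6 p₁ p₂ α₁ α₂ p₁-prime p₂-prime 2∤p₁ 2∤p₂ p₁<p₂ _ _ =
  Construction.nice α₁ α₂ p₁-prime p₂-prime
    (odd-prime⇒>2 p₁-prime 2∤p₁) (odd-prime⇒>2 p₂-prime 2∤p₂)
    (prime<prime⇒coprime p₁-prime p₂-prime p₁<p₂)
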